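{- Let $\pi$ be any arrival order of the items and let $A^i$ denote Greedy's allocation of the first $i$ arriving items. If item $j$ arrives at position $i+1$ under $\pi$, then the increase in welfare that Greedy achieves by allocating $j$ is at least $Gain(j,A^i)$.
   Context: Online SWM: items $N$ ($|N|=n$), agents $M$, each agent $\ell$ with monotone submodular valuation $v_\ell:2^N\to\mathbb{R}_{\ge0}$, $v_\ell(\emptyset)=0$. Greedy assigns each arriving item to an agent maximizing the marginal increase $v_\ell(S_\ell\cup\{j\})-v_\ell(S_\ell)$ of its current set $S_\ell$. An allocation $A=(A_\ell)_{\ell\in M}$ is a collection of disjoint item sets (some items may be unallocated), with value $V(A)=\sum_\ell v_\ell(A_\ell)$. Fix an optimal allocation $A^*$ of all items and, for each item $j$, let $opt_j$ be the agent with $j\in A^*_{opt_j}$. Fix an arbitrary permutation $\sigma$ of the items (independent of the arrival order) and let $\sigma^i$ be the set of its first $i$ items. For item $j$ at position $i+1$ of $\sigma$, $\ell=opt_j$, and allocation $A$: $Gain(j,A)=v_\ell(\{j\}\cup A_\ell\cup(A^*_\ell\cap\sigma^i))-v_\ell(A_\ell\cup(A^*_\ell\cap\sigma^i))$. -}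

module Defs where

open import Data.Nat using (ℕ; zero; suc; _<?_)
open import Data.Fin using (Fin; toℕ) renaming (_≟_ to _≟ᶠ_)
open import Data.Fin.Subset using (Subset; ⊥; _∪_; _∩_; ⁅_⁆; _⊆_; _∉_)
open import Data.Fin.Permutation using (Permutation′; _⟨$⟩ʳ_; _⟨$⟩ˡ_)
open import Data.Maybe using (Maybe; just; nothing)
open import Data.Maybe.Properties using (≡-dec)
open import Data.Vec using (tabulate)
open import Data.Product using (Σ; _×_)
open import Relation.Nullary using (¬_; does)
open import Relation.Binary.PropositionalEquality using (_≡_)
open import Algebra.Structures using (IsAbelianGroup)
open import Relation.Binary.Structures using (IsTotalOrder)

-- Value domain: a totally ordered abelian group (ℝ is one; the paper's
-- valuations are real valued).

record OrderedAbelianGroup : Set₁ where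
  infixl 6 _+_ _-_
  infix 4 _≤_
  field
    Carrier        : Set
    0#             : Carrier
    _+_            : Carrier → Carrier → Carrier
    -_             : Carrier → Carrier
    isAbelianGroup : IsAbelianGroup _≡_ _+_ 0# -_
    _≤_            : Carrier → Carrier → Set
    isTotalOrder   : IsTotalOrder _≡_ _≤_
    +-monoˡ-≤      : ∀ {x y} z → x ≤ y → x + z ≤ y + z

  _-_ : Carrier → Carrier → Carrier
  x - y = x + (- y)

module _ (R : OrderedAbelianGroup) where
  open OrderedAbelianGroup R

  sumFin : ∀ {m} → (Fin m → Carrier) → Carrier
  sumFin {zero}  f = 0#
  sumFin {suc m} f = f Fin.zero + sumFin (λ i → f (Fin.suc i))

  Valuation : ℕ → Set
  Valuation n = Subset n → Carrier

  Normalized : ∀ {n} → Valuation n → Set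
  Normalized v = v ⊥ ≡ 0#

  NonNegative : ∀ {n} → Valuation n → Set
  NonNegative v = ∀ S → 0# ≤ v S

  Monotone : ∀ {n} → Valuation n → Set
  Monotone v = ∀ {S T} → S ⊆ T → v S ≤ v T

  Submodular : ∀ {n} → Valuation n → Set
  Submodular v = ∀ {S T} j → S ⊆ T → j ∉ T →
    v (T ∪ ⁅ j ⁆) - v T ≤ v (S ∪ ⁅ j ⁆) - v S

  record Valuations (n m : ℕ) : Set where
    field
      v           : Fin m → Valuation n
      normalized  : ∀ ℓ → Normalized (v ℓ)
      nonNegative : ∀ ℓ → NonNegative (v ℓ)
      monotone    : ∀ ℓ → Monotone (v ℓ)
      submodular  : ∀ ℓ → Submodular (v ℓ)

  -- Allocations: each item is given to at most one agent (nothing =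
  -- unallocated).  Disjointness of bundles is built in.
  Allocation : ℕ → ℕ → Set
  Allocation n m = Fin n → Maybe (Fin m)

  bundle : ∀ {n m} → Allocation n m → Fin m → Subset n
  bundle A ℓ = tabulate (λ k → does (≡-dec _≟ᶠ_ (A k) (just ℓ)))

  module _ {n m : ℕ} (V : Valuations n m) where
    open Valuations V

    welfare : Allocation n m → Carrier
    welfare A = sumFin (λ ℓ → v ℓ (bundle A ℓ))

    marginal : Allocation n m → Fin m → Fin n → Carrier
    marginal A ℓ j = v ℓ (bundle A ℓ ∪ ⁅ j ⁆) - v ℓ (bundle A ℓ)

    -- an allocation of all items, given as the map j ↦ opt_j
    Optimal : (Fin n → Fin m) → Set
    Optimal opt = ∀ (B : Allocation n m) →
      welfare B ≤ welfare (λ j → just (opt j))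

    GreedyStep : Allocation n m → Fin n → Allocation n m → Set
    GreedyStep A j A′ = Σ (Fin m) λ ℓ →
      (∀ ℓ′ → marginal A ℓ′ j ≤ marginal A ℓ j) ×
      (A′ j ≡ just ℓ) ×
      (∀ k → ¬ (k ≡ j) → A′ k ≡ A k)

    -- a run of Greedy on arrival order π (π ⟨$⟩ʳ i = item at position i+1);
    -- alloc i = A^i, the allocation of the first i arriving items.
    record GreedyRun (π : Permutation′ n) : Set where
      field
        alloc : ℕ → Allocation n m
        start : ∀ j → alloc 0 j ≡ nothing
        step  : ∀ (i : Fin n) →
          GreedyStep (alloc (toℕ i)) (π ⟨$⟩ʳ i) (alloc (suc (toℕ i)))

    -- σ^p : the first p items of σ (σ ⟨$⟩ʳ k = item at position k+1)
    prefix : Permutation′ n → ℕ → Subset n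
    prefix σ p = tabulate (λ k → does (toℕ (σ ⟨$⟩ˡ k) <? p))

    Gain : (opt : Fin n → Fin m) → Permutation′ n → Fin n →
           Allocation n m → Carrier
    Gain opt σ j A =
      v ℓ (⁅ j ⁆ ∪ T) - v ℓ T
      where
        ℓ : Fin m
        ℓ = opt j
        T : Subset n
        T = bundle A ℓ ∪ (bundle (λ k → just (opt k)) ℓ ∩ prefix σ (toℕ (σ ⟨$⟩ˡ j)))

-- Greedy gives the arriving item j to an agent of maximal marginal value, so the welfare
-- increase is at least the marginal value of j for opt_j at its current bundle S.
-- Gain(j, A) is the marginal value of j for opt_j at S ∪ Y, where Y are the items of
-- A*_{opt_j} preceding j in σ; since j is unallocated and does not precede itself,
-- j ∉ S ∪ Y, and submodularity bounds Gain(j, A) by the marginal value at S.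
module Submission where

open import Defs
open import Data.Nat using (ℕ; zero; suc; _<?_)
import Data.Nat as Nat
open import Data.Nat.Properties using (<⇒≤; <-irrefl; n<1+n; m<n⇒m<1+n)
open import Data.Fin using (Fin; toℕ; fromℕ<) renaming (_≟_ to _≟ᶠ_)
open import Data.Fin.Properties using (suc-injective; toℕ-fromℕ<; toℕ<n)
open import Data.Fin.Permutation using (Permutation′; _⟨$⟩ʳ_; _⟨$⟩ˡ_)
open import Data.Fin.Subset using (_∪_; _∩_; ⁅_⁆; _∈_; _∉_; _⊆_)
open import Data.Fin.Subset.Properties
  using (⊆-antisym; ∪-comm; p⊆p∪q; x∈p∪q⁺; x∈p∪q⁻; x∈p∩q⁻; x∈⁅x⁆; x∈⁅y⁆⇒x≡y)
open import Data.Vec.Properties using (lookup∘tabulate; []=⇒lookup; lookup⇒[]=)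
open import Data.Maybe using (just; nothing)
open import Data.Maybe.Properties using (≡-dec; just-injective)
open import Data.Bool using (true)
open import Data.Product using (_,_)
open import Data.Sum using (inj₁; inj₂)
open import Function.Base using (_∘_)
open import Function.Bundles using (Injection)
open import Function.Properties.Inverse using (↔⇒↣)
open import Data.Vec.Functional using (tail)
open import Relation.Nullary using (Dec; does; proof; yes; no; contradiction)
open import Relation.Nullary.Reflects using (Reflects; invert)
open import Relation.Nullary.Decidable using (dec-true)
open import Relation.Binary.PropositionalEquality
  using (_≡_; _≢_; refl; sym; trans; cong; cong₂; subst; module ≡-Reasoning)
open import Algebra.Bundles using (AbelianGroup)
open import Relation.Binary.Structures using (IsTotalOrder)

does≡true⇒witness : ∀ {p} {P : Set p} (P? : Dec P) → does P? ≡ true → P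
does≡true⇒witness P? does≡true = invert (subst (Reflects _) does≡true (proof P?))

module _ (R : OrderedAbelianGroup) where
  open OrderedAbelianGroup R

  private
    abelianGroup : AbelianGroup _ _
    abelianGroup = record { isAbelianGroup = isAbelianGroup }

  open AbelianGroup abelianGroup using (assoc; comm; inverseʳ; identityˡ)
  open import Algebra.Properties.AbelianGroup abelianGroup using (⁻¹-∙-comm)

  [x+z]-[y+z]≡x-y : ∀ x y z → (x + z) - (y + z) ≡ x - y
  [x+z]-[y+z]≡x-y x y z = begin
    (x + z) + - (y + z)       ≡⟨ cong ((x + z) +_) (sym (⁻¹-∙-comm y z)) ⟩
    (x + z) + (- y + - z)     ≡⟨ assoc x z _ ⟩
    x + (z + (- y + - z))     ≡⟨ cong (λ w → x + (z + w)) (comm (- y) (- z)) ⟩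
    x + (z + (- z + - y))     ≡⟨ cong (x +_) (sym (assoc z (- z) (- y))) ⟩
    x + ((z + - z) + - y)     ≡⟨ cong (λ w → x + (w + - y)) (inverseʳ z) ⟩
    x + (0# + - y)            ≡⟨ cong (x +_) (identityˡ (- y)) ⟩
    x + - y                   ∎
    where open ≡-Reasoning

  [z+x]-[z+y]≡x-y : ∀ x y z → (z + x) - (z + y) ≡ x - y
  [z+x]-[z+y]≡x-y x y z =
    trans (cong₂ _-_ (comm z x) (comm z y)) ([x+z]-[y+z]≡x-y x y z)

  sumFin-cong : ∀ {m} {f g : Fin m → Carrier} → (∀ ℓ → f ℓ ≡ g ℓ) → sumFin R f ≡ sumFin R g
  sumFin-cong {zero}  f≗g = refl
  sumFin-cong {suc m} f≗g = cong₂ _+_ (f≗g Fin.zero) (sumFin-cong (λ ℓ → f≗g (Fin.suc ℓ)))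

  sumFin-update : ∀ {m} (f f′ : Fin m → Carrier) (g : Fin m) →
                  (∀ ℓ → ℓ ≢ g → f′ ℓ ≡ f ℓ) →
                  sumFin R f′ - sumFin R f ≡ f′ g - f g
  sumFin-update f f′ Fin.zero agree =
    trans (cong (λ s → (f′ Fin.zero + s) - sumFin R f)
                (sumFin-cong (λ ℓ → agree (Fin.suc ℓ) λ ())))
          ([x+z]-[y+z]≡x-y _ _ _)
  sumFin-update f f′ (Fin.suc g) agree = begin
    (f′ Fin.zero + sumFin R (tail f′)) - (f Fin.zero + sumFin R (tail f))
      ≡⟨ cong (λ x → (x + sumFin R (tail f′)) - _) (agree Fin.zero λ ()) ⟩
    (f Fin.zero + sumFin R (tail f′)) - (f Fin.zero + sumFin R (tail f))
      ≡⟨ [z+x]-[z+y]≡x-y _ _ _ ⟩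
    sumFin R (tail f′) - sumFin R (tail f)
      ≡⟨ sumFin-update (tail f) (tail f′) g
           (λ ℓ ℓ≢g → agree (Fin.suc ℓ) (ℓ≢g ∘ suc-injective)) ⟩
    f′ (Fin.suc g) - f (Fin.suc g) ∎
    where open ≡-Reasoning

  module _ {n m : ℕ} (V : Valuations R n m) where
    open Valuations V

    ∈-bundle⁺ : ∀ (A : Allocation R n m) {ℓ k} → A k ≡ just ℓ → k ∈ bundle R A ℓ
    ∈-bundle⁺ A {ℓ} {k} Ak≡ℓ =
      lookup⇒[]= k _
        (trans (lookup∘tabulate _ k) (dec-true (≡-dec _≟ᶠ_ (A k) (just ℓ)) Ak≡ℓ))

    ∈-bundle⁻ : ∀ (A : Allocation R n m) {ℓ k} → k ∈ bundle R A ℓ → A k ≡ just ℓ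
    ∈-bundle⁻ A {ℓ} {k} k∈ =
      does≡true⇒witness (≡-dec _≟ᶠ_ (A k) (just ℓ))
        (trans (sym (lookup∘tabulate _ k)) ([]=⇒lookup k∈))

    ∈-prefix⁻ : ∀ σ {p k} → k ∈ prefix R V σ p → toℕ (σ ⟨$⟩ˡ k) Nat.< p
    ∈-prefix⁻ σ {p} {k} k∈ =
      does≡true⇒witness (toℕ (σ ⟨$⟩ˡ k) <? p)
        (trans (sym (lookup∘tabulate _ k)) ([]=⇒lookup k∈))

    ∉-prefix-position : ∀ σ j → j ∉ prefix R V σ (toℕ (σ ⟨$⟩ˡ j))
    ∉-prefix-position σ j j∈ = <-irrefl refl (∈-prefix⁻ σ j∈)

    ∉-bundle-unallocated : ∀ (A : Allocation R n m) {j} → A j ≡ nothing → ∀ ℓ → j ∉ bundle R A ℓ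
    ∉-bundle-unallocated A Aj≡nothing ℓ j∈ with () ← trans (sym Aj≡nothing) (∈-bundle⁻ A j∈)

    module Assignment (A A′ : Allocation R n m) {j : Fin n} {ℓ₀ : Fin m}
                      (unallocated : A j ≡ nothing) (assigned : A′ j ≡ just ℓ₀)
                      (unchanged : ∀ k → k ≢ j → A′ k ≡ A k) where

      bundle-assigned : bundle R A′ ℓ₀ ≡ bundle R A ℓ₀ ∪ ⁅ j ⁆
      bundle-assigned = ⊆-antisym ⊆-∪ ∪-⊆
        where
        ⊆-∪ : bundle R A′ ℓ₀ ⊆ bundle R A ℓ₀ ∪ ⁅ j ⁆
        ⊆-∪ {k} k∈ with k ≟ᶠ j
        ... | yes refl = x∈p∪q⁺ (inj₂ (x∈⁅x⁆ j))
        ... | no k≢j   =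
          x∈p∪q⁺ (inj₁ (∈-bundle⁺ A (trans (sym (unchanged k k≢j)) (∈-bundle⁻ A′ k∈))))
        ∪-⊆ : bundle R A ℓ₀ ∪ ⁅ j ⁆ ⊆ bundle R A′ ℓ₀
        ∪-⊆ {k} k∈ with x∈p∪q⁻ _ _ k∈
        ... | inj₂ k∈⁅j⁆ =
          subst (_∈ bundle R A′ ℓ₀) (sym (x∈⁅y⁆⇒x≡y j k∈⁅j⁆)) (∈-bundle⁺ A′ assigned)
        ... | inj₁ k∈A with k ≟ᶠ j
        ...   | yes refl = ∈-bundle⁺ A′ assigned
        ...   | no k≢j   = ∈-bundle⁺ A′ (trans (unchanged k k≢j) (∈-bundle⁻ A k∈A))

      bundle-unaffected : ∀ ℓ → ℓ ≢ ℓ₀ → bundle R A′ ℓ ≡ bundle R A ℓ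
      bundle-unaffected ℓ ℓ≢ℓ₀ = ⊆-antisym ⊆A ⊆A′
        where
        ⊆A : bundle R A′ ℓ ⊆ bundle R A ℓ
        ⊆A {k} k∈ with k ≟ᶠ j
        ... | yes refl =
          contradiction (just-injective (trans (sym assigned) (∈-bundle⁻ A′ k∈))) (ℓ≢ℓ₀ ∘ sym)
        ... | no k≢j   = ∈-bundle⁺ A (trans (sym (unchanged k k≢j)) (∈-bundle⁻ A′ k∈))
        ⊆A′ : bundle R A ℓ ⊆ bundle R A′ ℓ
        ⊆A′ {k} k∈ with k ≟ᶠ j
        ... | yes refl = contradiction k∈ (∉-bundle-unallocated A unallocated ℓ)
        ... | no k≢j   = ∈-bundle⁺ A′ (trans (unchanged k k≢j) (∈-bundle⁻ A k∈))

      welfare-increase : welfare R V A′ - welfare R V A ≡ marginal R V A ℓ₀ j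
      welfare-increase = begin
        welfare R V A′ - welfare R V A
          ≡⟨ sumFin-update _ _ ℓ₀ (λ ℓ ℓ≢ℓ₀ → cong (v ℓ) (bundle-unaffected ℓ ℓ≢ℓ₀)) ⟩
        v ℓ₀ (bundle R A′ ℓ₀) - v ℓ₀ (bundle R A ℓ₀)
          ≡⟨ cong (λ S → v ℓ₀ S - v ℓ₀ (bundle R A ℓ₀)) bundle-assigned ⟩
        marginal R V A ℓ₀ j ∎
        where open ≡-Reasoning

    marginal≤greedyStep-increase : ∀ A A′ {j} → GreedyStep R V A j A′ → A j ≡ nothing →
      ∀ ℓ → marginal R V A ℓ j ≤ welfare R V A′ - welfare R V A
    marginal≤greedyStep-increase A A′ (ℓ₀ , maximal , assigned , unchanged) unallocated ℓ =
      subst (marginal R V A ℓ _ ≤_) (sym welfare-increase) (maximal ℓ)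
      where open Assignment A A′ unallocated assigned unchanged

    Gain≤marginal-opt : ∀ opt σ (A : Allocation R n m) {j} → A j ≡ nothing →
      Gain R V opt σ j A ≤ marginal R V A (opt j) j
    Gain≤marginal-opt opt σ A {j} unallocated =
      subst (λ U → v ℓ U - v ℓ (S ∪ Y) ≤ marginal R V A ℓ j) (∪-comm (S ∪ Y) ⁅ j ⁆)
        (submodular ℓ j (p⊆p∪q Y) j∉S∪Y)
      where
      ℓ = opt j
      S = bundle R A ℓ
      Y = bundle R (λ k → just (opt k)) ℓ ∩ prefix R V σ (toℕ (σ ⟨$⟩ˡ j))
      j∉S∪Y : j ∉ S ∪ Y
      j∉S∪Y j∈ with x∈p∪q⁻ S Y j∈
      ... | inj₁ j∈S = ∉-bundle-unallocated A unallocated ℓ j∈S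
      ... | inj₂ j∈Y with _ , j∈prefix ← x∈p∩q⁻ _ _ j∈Y = ∉-prefix-position σ j j∈prefix

    module _ {π : Permutation′ n} (G : GreedyRun R V π) where
      open GreedyRun G

      unallocated-before-arrival : ∀ p → p Nat.≤ n → ∀ j →
        (∀ k → toℕ k Nat.< p → π ⟨$⟩ʳ k ≢ j) → alloc p j ≡ nothing
      unallocated-before-arrival zero    _   j notArrived = start j
      unallocated-before-arrival (suc p) p<n j notArrived with step (fromℕ< p<n)
      ... | _ , _ , _ , unchanged = begin
        alloc (suc p) j        ≡⟨ cong (λ q → alloc (suc q) j) (sym position) ⟩
        alloc (suc (toℕ k)) j  ≡⟨ unchanged j (k-notArrived ∘ sym) ⟩
        alloc (toℕ k) j        ≡⟨ cong (λ q → alloc q j) position ⟩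
        alloc p j              ≡⟨ unallocated-before-arrival p (<⇒≤ p<n) j
                                    (λ k′ k′<p → notArrived k′ (m<n⇒m<1+n k′<p)) ⟩
        nothing                ∎
        where
        open ≡-Reasoning
        k = fromℕ< p<n
        position : toℕ k ≡ p
        position = toℕ-fromℕ< p<n
        k-notArrived : π ⟨$⟩ʳ k ≢ j
        k-notArrived = notArrived k (subst (Nat._< suc p) (sym position) (n<1+n p))

      unallocated-on-arrival : ∀ i → alloc (toℕ i) (π ⟨$⟩ʳ i) ≡ nothing
      unallocated-on-arrival i = unallocated-before-arrival (toℕ i) (<⇒≤ (toℕ<n i)) (π ⟨$⟩ʳ i)
        (λ k k<i πk≡πi → <-irrefl (cong toℕ (Injection.injective (↔⇒↣ π) πk≡πi)) k<i)

lemma2p3 : (R : OrderedAbelianGroup) → let open OrderedAbelianGroup R in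
    {n m : ℕ} (V : Valuations R n m)
    (opt : Fin n → Fin m) → Optimal R V opt →
    (σ : Permutation′ n) (π : Permutation′ n) (G : GreedyRun R V π) →
    let open GreedyRun G in
    (i : Fin n) (j : Fin n) → π ⟨$⟩ʳ i ≡ j →
    Gain R V opt σ j (alloc (toℕ i))
      ≤ welfare R V (alloc (suc (toℕ i))) - welfare R V (alloc (toℕ i))
lemma2p3 R V opt _ σ π G i .(π ⟨$⟩ʳ i) refl =
  ≤-trans (Gain≤marginal-opt R V opt σ A unallocated)
          (marginal≤greedyStep-increase R V A _ (step i) unallocated (opt (π ⟨$⟩ʳ i)))
  where
  open OrderedAbelianGroup R
  open IsTotalOrder isTotalOrder using () renaming (trans to ≤-trans)
  open GreedyRun G
  A = alloc (toℕ i)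
  unallocated = unallocated-on-arrival R V G i
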